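{- Let $c_\star=\frac{\sqrt{13}-1}{6}$. For every $\varepsilon>0$ there exist $\delta>0$ and $n_0\in\mathbb{N}$ such that the following holds for every $n\ge n_0$: if $H$ is a $3$-graph on $n+1$ vertices with minimum vertex degree at least $(c_\star-\delta)\frac{n^2}{2}$, and $x\in V(H)$ is a vertex not contained in any copy of $K_4^{(3)- }$ in $H$, then the link graph $H_x$ can be made bipartite by removing at most $\varepsilon n^2$ edges.
   Context: A $3$-graph is a $3$-uniform hypergraph; the minimum vertex degree is the minimum over vertices $v$ of the number of edges containing $v$. $K_4^{(3)- }$ is the $3$-graph on $4$ vertices with exactly $3$ edges. The link graph $H_x$ of a vertex $x$ is the graph on $V(H)\setminus\{x\}$ whose edges are the pairs $yz$ with $\{x,y,z\}\in E(H)$.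
   Formalization: The parameter ε ranges over the positive rationals rather than all positive reals, and the witness δ is taken in the rationals. -}

module Defs where

open import Data.Bool using (Bool; true; false; _∧_; if_then_else_)
open import Data.Nat as ℕ using (ℕ; zero; suc; _<ᵇ_)
open import Data.Fin using (Fin; toℕ)
open import Data.List using (List; length; filterᵇ; cartesianProduct; allFin)
open import Data.Product using (_×_; _,_; Σ; ∃; ∃-syntax)
open import Data.Integer using (+_)
open import Data.Rational using (ℚ; _+_; _*_; _≤_; 0ℚ; _/_)
open import Relation.Binary.PropositionalEquality using (_≡_; _≢_)

ℕtoℚ : ℕ → ℚ
ℕtoℚ k = (+ k) / 1

-- c⋆ = (√13 - 1)/6.  For a ≥ 0, "c⋆ · a ≤ b" holds iff
--   √13 · a ≤ 6b + a   iff   0 ≤ 6b + a  and  13 a² ≤ (6b + a)².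
-- (Only used with a ≥ 0.)
CStarTimes_≤_ : ℚ → ℚ → Set
CStarTimes a ≤ b =
  (0ℚ ≤ (ℕtoℚ 6 * b + a)) × (ℕtoℚ 13 * (a * a) ≤ (ℕtoℚ 6 * b + a) * (ℕtoℚ 6 * b + a))

record ThreeGraph (m : ℕ) : Set where
  field
    edge      : Fin m → Fin m → Fin m → Bool
    sym₁₂     : ∀ x y z → edge x y z ≡ edge y x z
    sym₂₃     : ∀ x y z → edge x y z ≡ edge x z y
    distinct  : ∀ x y z → edge x y z ≡ true → (x ≢ y) × (y ≢ z) × (x ≢ z)
open ThreeGraph public

countPairs : {m : ℕ} → (Fin m → Fin m → Bool) → ℕ
countPairs {m} P =
  length (filterᵇ (λ { (y , z) → (toℕ y <ᵇ toℕ z) ∧ P y z })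
                  (cartesianProduct (allFin m) (allFin m)))

link : {m : ℕ} → ThreeGraph m → Fin m → Fin m → Fin m → Bool
link H x y z = edge H x y z

degree : {m : ℕ} → ThreeGraph m → Fin m → ℕ
degree H v = countPairs (link H v)

b2n : Bool → ℕ
b2n true  = 1
b2n false = 0

K4minusCopy : {m : ℕ} → ThreeGraph m → Fin m → Fin m → Fin m → Fin m → Set
K4minusCopy H x y z w =
  (x ≢ y) × (x ≢ z) × (x ≢ w) × (y ≢ z) × (y ≢ w) × (z ≢ w) ×
  (3 ℕ.≤ b2n (edge H x y z) ℕ.+ b2n (edge H x y w) ℕ.+ b2n (edge H x z w) ℕ.+ b2n (edge H y z w))

NotInK4minus : {m : ℕ} → ThreeGraph m → Fin m → Set
NotInK4minus H x = ∀ y z w → K4minusCopy H x y z w → Data.Empty.⊥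
  where import Data.Empty

Bipartite : {m : ℕ} → (Fin m → Fin m → Bool) → Set
Bipartite {m} G = Σ (Fin m → Bool) λ col →
  ∀ y z → toℕ y ℕ.< toℕ z → G y z ≡ true → col y ≢ col z

_minus_ : {m : ℕ} → (Fin m → Fin m → Bool) → (Fin m → Fin m → Bool) → (Fin m → Fin m → Bool)
(G minus F) y z = if F y z then false else G y z

BipartiteAfterRemoving : {m : ℕ} → (Fin m → Fin m → Bool) → ℚ → Set
BipartiteAfterRemoving {m} G r = Σ (Fin m → Fin m → Bool) λ F →
  (∀ y z → F y z ≡ true → G y z ≡ true) ×
  (ℕtoℚ (countPairs F) ≤ r) ×
  Bipartite (G minus F)

-- minimum vertex degree ≥ (c⋆ - δ) n²/2, written as c⋆·n² ≤ 2·deg(v) + δ·n²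
MinDegreeCond : {m : ℕ} → ThreeGraph m → ℕ → ℚ → Set
MinDegreeCond H n δ = ∀ v →
  CStarTimes ℕtoℚ (n ℕ.* n) ≤ (ℕtoℚ (2 ℕ.* degree H v) + δ * ℕtoℚ (n ℕ.* n))

-- If x lies in no copy of K₄⁽³⁾⁻, its link graph G is triangle-free, and for every pair y, z the
-- vertices w with yzw ∈ H, the common G-neighbours of y and z and, if yz ∈ G, the G-neighbours of
-- y and those of z form pairwise disjoint sets.  Summing over z and then y gives
-- ∑_y 2·deg(y) + 3·∑_y d(y)² ≤ (n+1)³, where d is the degree in G.  Since D = 2·(minimum degree)
-- is at most ∑_y d(y), this bounds 3·∑_y (n·d(y) − D)² by n·(n⁴ − n²D − 3D²) + O(n⁴), and the
-- minimum degree condition makes the bracket O(δn⁴), because c⋆ is the positive root of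
-- 1 − t − 3t².  So only O(1 + δn) vertices have link degree below 21n/50 < c⋆n.  Deleting the
-- G-edges at these low vertices leaves a triangle-free graph in which every other vertex has more
-- than 2(n+1)/5 neighbours; it has no 5-cycle, hence colouring w by whether w has a common
-- neighbour with a fixed vertex u is proper.

module Submission where

open import Defs

module _ where

  open import Data.Bool using (Bool; true; false; _∧_; _∨_; not; if_then_else_)
  open import Data.Nat
  open import Data.Nat.Properties
  open import Data.Fin using (Fin; zero; suc; toℕ)
  open import Data.Fin.Patterns using (0F; 1F; 2F; 3F; 4F)
  open import Data.Fin.Properties using (toℕ-injective; any?)
  open import Data.List.Extrema ≤-totalOrder using (argmin; f[argmin]≤f[xs])
  open import Data.List.Membership.Propositional.Properties using (∈-allFin)
  import Data.List.Relation.Unary.All as All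
  open import Data.List as List using (List; []; _∷_; _++_; length; filterᵇ; cartesianProduct; allFin; tabulate)
  open import Data.Product using (_×_; _,_; proj₁; proj₂; ∃-syntax)
  open import Data.Empty using (⊥; ⊥-elim)
  open import Data.Sum using (inj₁; inj₂)
  open import Function using (_∘_)
  open import Relation.Binary.PropositionalEquality
    using (_≡_; _≢_; refl; sym; trans; cong; cong₂; subst; subst₂; module ≡-Reasoning)
  open import Relation.Binary.Definitions using (tri<; tri≈; tri>)
  open import Relation.Nullary using (¬_; Dec; yes; no; contradiction)
  open import Relation.Nullary.Decidable using (isYes; _×-dec_; toWitness; toWitnessFalse)
  open import Function.Bundles using (module Equivalence)
  open import Data.Bool.Properties using (T-≡; T-not-≡; ∨-conicalˡ; ∨-conicalʳ)
  import Data.Bool as Bool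
  open import Data.Nat.Tactic.RingSolver using (solve-∀)
  open import Algebra.Properties.Semiring.Sum +-*-semiring
    using (sum; sum-cong-≗; ∑-distrib-+; ∑-comm; *-distribˡ-sum; *-distribʳ-sum)
  import Data.Integer as ℤ
  import Data.Integer.Properties as ℤ
  open import Data.Rational using (ℚ)
  import Data.Rational as ℚ
  import Data.Rational.Properties as ℚ
  import Data.Rational.Unnormalised as ℚᵘ
  import Data.Rational.Unnormalised.Properties as ℚᵘ
  import Data.Nat.Coprimality as Coprime
  import Data.Rational.Solver as ℚ-Solver

  -- Finite sums

  sum-mono-≤ : ∀ {m} {f g : Fin m → ℕ} → (∀ i → f i ≤ g i) → sum f ≤ sum g
  sum-mono-≤ {zero}  f≤g = z≤n
  sum-mono-≤ {suc m} f≤g = +-mono-≤ (f≤g zero) (sum-mono-≤ (f≤g ∘ suc))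

  sum-const : ∀ m c → sum {m} (λ _ → c) ≡ m * c
  sum-const zero    c = refl
  sum-const (suc m) c = cong (c +_) (sum-const m c)

  ∑-distrib-+₃ : ∀ {m} (f g h : Fin m → ℕ) → sum (λ i → f i + g i + h i) ≡ sum f + sum g + sum h
  ∑-distrib-+₃ f g h = trans (∑-distrib-+ (λ i → f i + g i) h) (cong (_+ sum h) (∑-distrib-+ f g))

  sum-b2n<⇒∃false : ∀ {m} (P : Fin m → Bool) → sum (b2n ∘ P) < m → ∃[ i ] P i ≡ false
  sum-b2n<⇒∃false {suc m} P sum<m with P zero in P0
  ... | false = zero , P0
  ... | true  with sum-b2n<⇒∃false (P ∘ suc) (≤-pred sum<m)
  ...   | i , Pi = suc i , Pi

  sumᴸ : {A : Set} → (A → ℕ) → List A → ℕ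
  sumᴸ f = List.foldr (λ a s → f a + s) 0

  sumᴸ-++ : {A : Set} (f : A → ℕ) (xs ys : List A) → sumᴸ f (xs ++ ys) ≡ sumᴸ f xs + sumᴸ f ys
  sumᴸ-++ f []       ys = refl
  sumᴸ-++ f (x ∷ xs) ys = trans (cong (f x +_) (sumᴸ-++ f xs ys)) (sym (+-assoc (f x) _ _))

  sumᴸ-map : {A B : Set} (f : B → ℕ) (g : A → B) (xs : List A) → sumᴸ f (List.map g xs) ≡ sumᴸ (f ∘ g) xs
  sumᴸ-map f g []       = refl
  sumᴸ-map f g (x ∷ xs) = cong (f (g x) +_) (sumᴸ-map f g xs)

  sumᴸ-cong : {A : Set} {f g : A → ℕ} (xs : List A) → (∀ x → f x ≡ g x) → sumᴸ f xs ≡ sumᴸ g xs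
  sumᴸ-cong []       f≗g = refl
  sumᴸ-cong (x ∷ xs) f≗g = cong₂ _+_ (f≗g x) (sumᴸ-cong xs f≗g)

  length-filterᵇ : {A : Set} (p : A → Bool) (xs : List A) → length (filterᵇ p xs) ≡ sumᴸ (b2n ∘ p) xs
  length-filterᵇ p []       = refl
  length-filterᵇ p (x ∷ xs) with p x
  ... | true  = cong suc (length-filterᵇ p xs)
  ... | false = length-filterᵇ p xs

  sumᴸ-cartesianProduct : {A B : Set} (f : A × B → ℕ) (xs : List A) (ys : List B) →
    sumᴸ f (cartesianProduct xs ys) ≡ sumᴸ (λ x → sumᴸ (λ y → f (x , y)) ys) xs
  sumᴸ-cartesianProduct f []       ys = refl
  sumᴸ-cartesianProduct f (x ∷ xs) ys =
    trans (sumᴸ-++ f (List.map (x ,_) ys) _)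
          (cong₂ _+_ (sumᴸ-map f (x ,_) ys) (sumᴸ-cartesianProduct f xs ys))

  sumᴸ-tabulate : ∀ {m} {B : Set} (f : B → ℕ) (g : Fin m → B) → sumᴸ f (tabulate g) ≡ sum (f ∘ g)
  sumᴸ-tabulate {zero}  f g = refl
  sumᴸ-tabulate {suc m} f g = cong (f (g zero) +_) (sumᴸ-tabulate f (g ∘ suc))

  countPairs-∑ : ∀ {m} (P : Fin m → Fin m → Bool) →
    countPairs P ≡ sum (λ y → sum (λ z → b2n ((toℕ y <ᵇ toℕ z) ∧ P y z)))
  countPairs-∑ {m} P = begin
    countPairs P                                       ≡⟨ length-filterᵇ _ (cartesianProduct (allFin m) (allFin m)) ⟩
    sumᴸ (b2n ∘ ordered) (cartesianProduct (allFin m) (allFin m))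
      ≡⟨ sumᴸ-cartesianProduct (b2n ∘ ordered) (allFin m) (allFin m) ⟩
    sumᴸ (λ y → sumᴸ (λ z → [ y < z ]∧P) (allFin m)) (allFin m)
      ≡⟨ sumᴸ-cong (allFin m) (λ y → sumᴸ-tabulate (λ z → [ y < z ]∧P) (λ z → z)) ⟩
    sumᴸ (λ y → sum (λ z → [ y < z ]∧P)) (allFin m)
      ≡⟨ sumᴸ-tabulate (λ y → sum (λ z → [ y < z ]∧P)) (λ y → y) ⟩
    sum (λ y → sum (λ z → [ y < z ]∧P))                ∎
    where
    open ≡-Reasoning
    ordered : Fin m × Fin m → Bool
    ordered (y , z) = (toℕ y <ᵇ toℕ z) ∧ P y z
    [_<_]∧P : Fin m → Fin m → ℕ
    [ y < z ]∧P = b2n (ordered (y , z))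

  <ᵇ-true : ∀ {a b} → a < b → (a <ᵇ b) ≡ true
  <ᵇ-true a<b = Equivalence.to T-≡ (<⇒<ᵇ a<b)

  <ᵇ-true⇒< : ∀ {a b} → (a <ᵇ b) ≡ true → a < b
  <ᵇ-true⇒< {a} {b} eq = <ᵇ⇒< a b (Equivalence.from T-≡ eq)

  <ᵇ-false : ∀ {a b} → b ≤ a → (a <ᵇ b) ≡ false
  <ᵇ-false {a} {b} b≤a with a <ᵇ b in eq
  ... | false = refl
  ... | true  = contradiction (<ᵇ-true⇒< eq) (≤⇒≯ b≤a)

  <ᵇ-false⇒≥ : ∀ {a b} → (a <ᵇ b) ≡ false → b ≤ a
  <ᵇ-false⇒≥ {a} {b} eq with b ≤? a
  ... | yes b≤a = b≤a
  ... | no  b≰a = contradiction (trans (sym eq) (<ᵇ-true (≰⇒> b≰a))) λ ()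

  symmetric-pair-count : ∀ {m} (P : Fin m → Fin m → Bool) → (∀ y z → P y z ≡ P z y) → (∀ y → P y y ≡ false) →
    ∀ y z → b2n ((toℕ y <ᵇ toℕ z) ∧ P y z) + b2n ((toℕ z <ᵇ toℕ y) ∧ P z y) ≡ b2n (P y z)
  symmetric-pair-count P sym-P irrefl-P y z with <-cmp (toℕ y) (toℕ z)
  ... | tri< y<z _ _ rewrite <ᵇ-true y<z | <ᵇ-false (<⇒≤ y<z) = +-identityʳ _
  ... | tri> _ _ z<y rewrite <ᵇ-true z<y | <ᵇ-false (<⇒≤ z<y) | sym-P z y = refl
  ... | tri≈ _ y≡z _ rewrite toℕ-injective y≡z | irrefl-P z | <ᵇ-false (≤-refl {toℕ z}) = refl

  double-countPairs : ∀ {m} (P : Fin m → Fin m → Bool) → (∀ y z → P y z ≡ P z y) → (∀ y → P y y ≡ false) →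
    2 * countPairs P ≡ sum (λ y → sum (λ z → b2n (P y z)))
  double-countPairs {m} P sym-P irrefl-P = begin
    2 * countPairs P                        ≡⟨ cong (2 *_) (countPairs-∑ P) ⟩
    2 * A                                   ≡⟨ cong (A +_) (+-identityʳ A) ⟩
    A + A                                   ≡⟨ cong (A +_) (∑-comm (λ y z → below y z)) ⟩
    A + sum (λ y → sum (λ z → below z y))   ≡⟨ ∑-distrib-+ (λ y → sum (below y)) (λ y → sum (λ z → below z y)) ⟨
    sum (λ y → sum (below y) + sum (λ z → below z y))
      ≡⟨ sum-cong-≗ (λ y → ∑-distrib-+ (below y) (λ z → below z y)) ⟨
    sum (λ y → sum (λ z → below y z + below z y))
      ≡⟨ sum-cong-≗ (λ y → sum-cong-≗ (symmetric-pair-count P sym-P irrefl-P y)) ⟩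
    sum (λ y → sum (λ z → b2n (P y z)))     ∎
    where
    open ≡-Reasoning
    below : Fin m → Fin m → ℕ
    below y z = b2n ((toℕ y <ᵇ toℕ z) ∧ P y z)
    A : ℕ
    A = sum (λ y → sum (below y))

  b2n-∧ : ∀ a b → b2n (a ∧ b) ≡ b2n a * b2n b
  b2n-∧ true  b = sym (+-identityʳ (b2n b))
  b2n-∧ false b = refl

  three-true : ∀ {a b c} → a ≡ true → b ≡ true → c ≡ true → 3 ≤ b2n a + b2n b + b2n c
  three-true refl refl refl = ≤-refl

  link-weight-≤1 : ∀ (a b c e : Bool) →
    (a ≡ true → b ≡ true → c ≡ true → ⊥) → (a ≡ true → b ≡ true → e ≡ true → ⊥) →
    (b ≡ true → c ≡ true → e ≡ true → ⊥) → (a ≡ true → c ≡ true → e ≡ true → ⊥) →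
    b2n e + b2n (b ∧ c) + b2n a * (b2n b + b2n c) ≤ 1
  link-weight-≤1 true  true  true  _     abc _   _   _   = ⊥-elim (abc refl refl refl)
  link-weight-≤1 true  true  false true  _   abe _   _   = ⊥-elim (abe refl refl refl)
  link-weight-≤1 true  true  false false _   _   _   _   = s≤s z≤n
  link-weight-≤1 true  false true  true  _   _   _   ace = ⊥-elim (ace refl refl refl)
  link-weight-≤1 true  false true  false _   _   _   _   = s≤s z≤n
  link-weight-≤1 true  false false true  _   _   _   _   = s≤s z≤n
  link-weight-≤1 true  false false false _   _   _   _   = z≤n
  link-weight-≤1 false true  true  true  _   _   bce _   = ⊥-elim (bce refl refl refl)
  link-weight-≤1 false true  true  false _   _   _   _   = s≤s z≤n
  link-weight-≤1 false true  false true  _   _   _   _   = s≤s z≤n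
  link-weight-≤1 false true  false false _   _   _   _   = z≤n
  link-weight-≤1 false false _     true  _   _   _   _   = s≤s z≤n
  link-weight-≤1 false false _     false _   _   _   _   = z≤n

  -- The sums have the shape to which `sum` over Fin 5 (resp. Fin 3) unfolds, hence the trailing + 0.
  C₅-independent : ∀ p₀ p₁ p₂ p₃ p₄ →
    (p₀ ≡ true → p₁ ≡ true → ⊥) → (p₁ ≡ true → p₂ ≡ true → ⊥) →
    (p₂ ≡ true → p₃ ≡ true → ⊥) → (p₃ ≡ true → p₄ ≡ true → ⊥) → (p₄ ≡ true → p₀ ≡ true → ⊥) →
    b2n p₀ + (b2n p₁ + (b2n p₂ + (b2n p₃ + (b2n p₄ + 0)))) ≤ 2
  C₅-independent true  true  _     _     _     h _ _ _ _ = ⊥-elim (h refl refl)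
  C₅-independent _     true  true  _     _     _ h _ _ _ = ⊥-elim (h refl refl)
  C₅-independent _     _     true  true  _     _ _ h _ _ = ⊥-elim (h refl refl)
  C₅-independent _     _     _     true  true  _ _ _ h _ = ⊥-elim (h refl refl)
  C₅-independent true  _     _     _     true  _ _ _ _ h = ⊥-elim (h refl refl)
  C₅-independent true  false true  false false _ _ _ _ _ = ≤-refl
  C₅-independent true  false false true  false _ _ _ _ _ = ≤-refl
  C₅-independent true  false false false false _ _ _ _ _ = s≤s z≤n
  C₅-independent false true  false true  false _ _ _ _ _ = ≤-refl
  C₅-independent false true  false false true  _ _ _ _ _ = ≤-refl
  C₅-independent false true  false false false _ _ _ _ _ = s≤s z≤n
  C₅-independent false false true  false true  _ _ _ _ _ = ≤-refl
  C₅-independent false false true  false false _ _ _ _ _ = s≤s z≤n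
  C₅-independent false false false true  false _ _ _ _ _ = s≤s z≤n
  C₅-independent false false false false true  _ _ _ _ _ = s≤s z≤n
  C₅-independent false false false false false _ _ _ _ _ = z≤n

  K₃-independent : ∀ p₀ p₁ p₂ →
    (p₀ ≡ true → p₁ ≡ true → ⊥) → (p₁ ≡ true → p₂ ≡ true → ⊥) →
    (p₀ ≡ true → p₂ ≡ true → ⊥) → b2n p₀ + (b2n p₁ + (b2n p₂ + 0)) ≤ 1
  K₃-independent true  true  _     h _ _ = ⊥-elim (h refl refl)
  K₃-independent _     true  true  _ h _ = ⊥-elim (h refl refl)
  K₃-independent true  _     true  _ _ h = ⊥-elim (h refl refl)
  K₃-independent true  false false _ _ _ = ≤-refl
  K₃-independent false true  false _ _ _ = ≤-refl
  K₃-independent false false true  _ _ _ = ≤-refl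
  K₃-independent false false false _ _ _ = z≤n

  minus-true : ∀ (f b : Bool) → (if f then false else b) ≡ true → (f ≡ false) × (b ≡ true)
  minus-true false true _ = refl , refl

  booleans-differ : ∀ {a b : Bool} → (a ≡ true → b ≡ true → ⊥) → (a ≡ false → b ≡ false → ⊥) → a ≢ b
  booleans-differ {true}  both-true _ refl = both-true refl refl
  booleans-differ {false} _ both-false refl = both-false refl refl

  high-weight-≤ : ∀ b {X c} → (b ≡ false → X ≤ c) → b2n (not b) * X ≤ c
  high-weight-≤ true  _   = z≤n
  high-weight-≤ false X≤c = subst (_≤ _) (sym (+-identityʳ _)) (X≤c refl)

  -- Arithmetic of the counting argument

  2*m*n≤m*m+n*n : ∀ a b → 2 * (a * b) ≤ a * a + b * b
  2*m*n≤m*m+n*n a b with ≤-total a b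
  ... | inj₁ a≤b = subst (λ b → 2 * (a * b) ≤ a * a + b * b) (m+[n∸m]≡n a≤b)
                     (≤-trans (m≤m+n _ _) (≤-reflexive (sym (expand a (b ∸ a)))))
    where
    expand : ∀ a e → a * a + (a + e) * (a + e) ≡ 2 * (a * (a + e)) + e * e
    expand = solve-∀
  ... | inj₂ b≤a = subst (λ a → 2 * (a * b) ≤ a * a + b * b) (m+[n∸m]≡n b≤a)
                     (≤-trans (m≤m+n _ _) (≤-reflexive (sym (expand b (a ∸ b)))))
    where
    expand : ∀ b e → (b + e) * (b + e) + b * b ≡ 2 * ((b + e) * b) + e * e
    expand = solve-∀

  -- Opaque: otherwise conversion checking unfolds products such as gap-scale * gap-scale * X one
  -- multiplication step at a time, which is prohibitively slow.
  opaque
    gap-scale : ℕ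
    gap-scale = 200

  opaque
    unfolding gap-scale

    1≤gap-scale : 1 ≤ gap-scale
    1≤gap-scale = s≤s z≤n

    low-degree-gap : ∀ n D dv → 17 * (n * n) ≤ 40 * D → 50 * dv < 21 * n → gap-scale * (n * dv) + n * n ≤ gap-scale * D
    low-degree-gap n D dv 17N≤40D 50dv<21n = begin
      200 * (n * dv) + n * n             ≤⟨ +-monoˡ-≤ (n * n) (m≤m+n (200 * (n * dv)) (4 * n)) ⟩
      200 * (n * dv) + 4 * n + n * n     ≡⟨ cong (_+ n * n) (e₁ n dv) ⟩
      4 * n * suc (50 * dv) + n * n      ≤⟨ +-monoˡ-≤ (n * n) (*-monoʳ-≤ (4 * n) 50dv<21n) ⟩
      4 * n * (21 * n) + n * n           ≡⟨ e₂ n ⟩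
      5 * (17 * (n * n))                 ≤⟨ *-monoʳ-≤ 5 17N≤40D ⟩
      5 * (40 * D)                       ≡⟨ e₃ D ⟩
      200 * D                            ∎
      where
      open ≤-Reasoning
      e₁ : ∀ n dv → 200 * (n * dv) + 4 * n ≡ 4 * n * suc (50 * dv)
      e₁ = solve-∀
      e₂ : ∀ n → 4 * n * (21 * n) + n * n ≡ 5 * (17 * (n * n))
      e₂ = solve-∀
      e₃ : ∀ D → 5 * (40 * D) ≡ 200 * D
      e₃ = solve-∀

  squared-deviation : ∀ r n D dv → 1 ≤ r → (low : Bool) → (low ≡ true → r * (n * dv) + n * n ≤ r * D) →
    b2n low * ((n * n) * (n * n)) + 2 * (r * r) * ((n * D) * dv) ≤ (r * r) * ((n * n) * (dv * dv) + D * D)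
  squared-deviation r n D dv _ false _ = begin
    2 * (r * r) * ((n * D) * dv)                   ≡⟨ e₁ r n D dv ⟩
    r * r * (2 * ((n * dv) * D))                   ≤⟨ *-monoʳ-≤ (r * r) (2*m*n≤m*m+n*n (n * dv) D) ⟩
    r * r * ((n * dv) * (n * dv) + D * D)          ≡⟨ e₂ r n D dv ⟩
    (r * r) * ((n * n) * (dv * dv) + D * D)        ∎
    where
    open ≤-Reasoning
    e₁ : ∀ r n D dv → 2 * (r * r) * ((n * D) * dv) ≡ r * r * (2 * ((n * dv) * D))
    e₁ = solve-∀
    e₂ : ∀ r n D dv → r * r * ((n * dv) * (n * dv) + D * D) ≡ r * r * ((n * n) * (dv * dv) + D * D)
    e₂ = solve-∀
  squared-deviation r n D dv 1≤r true gap = begin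
    1 * (N * N) + 2 * (r * r) * ((n * D) * dv)     ≡⟨ cong (_+ 2 * (r * r) * ((n * D) * dv)) (*-identityˡ (N * N)) ⟩
    N * N + 2 * (r * r) * ((n * D) * dv)           ≤⟨ +-monoˡ-≤ _ (*-mono-≤ N≤re N≤re) ⟩
    r * e * (r * e) + 2 * (r * r) * ((n * D) * dv) ≡⟨ subst (λ D → r * e * (r * e) + 2 * (r * r) * ((n * D) * dv)
                                                                ≡ (r * r) * (N * (dv * dv) + D * D))
                                                             ndv+e≡D (expand r n dv e) ⟩
    (r * r) * (N * (dv * dv) + D * D)              ∎
    where
    open ≤-Reasoning
    N : ℕ
    N = n * n
    ndv≤D : n * dv ≤ D
    ndv≤D = *-cancelˡ-≤ r ⦃ >-nonZero 1≤r ⦄ (≤-trans (m≤m+n (r * (n * dv)) N) (gap refl))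
    e : ℕ
    e = D ∸ n * dv
    ndv+e≡D : n * dv + e ≡ D
    ndv+e≡D = m+[n∸m]≡n ndv≤D
    N≤re : N ≤ r * e
    N≤re = +-cancelˡ-≤ (r * (n * dv)) N (r * e)
             (subst (r * (n * dv) + N ≤_) (trans (cong (r *_) (sym ndv+e≡D)) (*-distribˡ-+ r (n * dv) e)) (gap refl))
    expand : ∀ r n dv e → r * e * (r * e) + 2 * (r * r) * ((n * (n * dv + e)) * dv)
                          ≡ (r * r) * ((n * n) * (dv * dv) + (n * dv + e) * (n * dv + e))
    expand = solve-∀

  cstar-bound⇒17N≤40D : ∀ N K D → 1 ≤ N → 120 ≤ K →
    13 * (N * N) * (K * K) ≤ (6 * D * K + 6 * N + N * K) * (6 * D * K + 6 * N + N * K) → 17 * N ≤ 40 * D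
  cstar-bound⇒17N≤40D N K D 1≤N 120≤K 13N²K²≤X² with 17 * N ≤? 40 * D
  ... | yes 17N≤40D = 17N≤40D
  ... | no  17N≰40D =
    contradiction 13N²K²≤X² (<⇒≱ (*-cancelˡ-< 1600 (X * X) (13 * (N * N) * (K * K)) 1600X²<1600·13N²K²))
    where
    X : ℕ
    X = 6 * D * K + 6 * N + N * K
    P : ℕ
    P = N * N * (K * K)
    40D≤17N : 40 * D ≤ 17 * N
    40D≤17N = <⇒≤ (≰⇒> 17N≰40D)
    40X≤144KN : 40 * X ≤ 144 * (K * N)
    40X≤144KN = begin
      40 * X                                        ≡⟨ e₁ D N K ⟩
      6 * K * (40 * D) + 240 * N + 40 * (K * N)     ≤⟨ +-monoˡ-≤ (40 * (K * N)) (+-mono-≤ (*-monoʳ-≤ (6 * K) 40D≤17N)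
                                                                                       (*-monoˡ-≤ N (*-monoʳ-≤ 2 120≤K))) ⟩
      6 * K * (17 * N) + 2 * K * N + 40 * (K * N)   ≡⟨ e₂ N K ⟩
      144 * (K * N)                                 ∎
      where
      open ≤-Reasoning
      e₁ : ∀ D N K → 40 * (6 * D * K + 6 * N + N * K) ≡ 6 * K * (40 * D) + 240 * N + 40 * (K * N)
      e₁ = solve-∀
      e₂ : ∀ N K → 6 * K * (17 * N) + 2 * K * N + 40 * (K * N) ≡ 144 * (K * N)
      e₂ = solve-∀
    -- 144² = 20736 < 20800 = 40² · 13, i.e. 17/40 < c⋆.
    1600X²<1600·13N²K² : 1600 * (X * X) < 1600 * (13 * (N * N) * (K * K))
    1600X²<1600·13N²K² = begin-strict
      1600 * (X * X)                      ≡⟨ e₃ X ⟩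
      40 * X * (40 * X)                   ≤⟨ *-mono-≤ 40X≤144KN 40X≤144KN ⟩
      144 * (K * N) * (144 * (K * N))     ≡⟨ e₄ N K ⟩
      20736 * P                           <⟨ m<m+n (20736 * P) (≤-trans (s≤s z≤n) (*-monoʳ-≤ 64 1≤P)) ⟩
      20736 * P + 64 * P                  ≡⟨ e₅ N K ⟩
      1600 * (13 * (N * N) * (K * K))     ∎
      where
      open ≤-Reasoning
      1≤P : 1 ≤ P
      1≤P = *-mono-≤ (*-mono-≤ 1≤N 1≤N) (*-mono-≤ (≤-trans (s≤s z≤n) 120≤K) (≤-trans (s≤s z≤n) 120≤K))
      e₃ : ∀ X → 1600 * (X * X) ≡ 40 * X * (40 * X)
      e₃ = solve-∀
      e₄ : ∀ N K → 144 * (K * N) * (144 * (K * N)) ≡ 20736 * (N * N * (K * K))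
      e₄ = solve-∀
      e₅ : ∀ N K → 20736 * (N * N * (K * K)) + 64 * (N * N * (K * K)) ≡ 1600 * (13 * (N * N) * (K * K))
      e₅ = solve-∀

  -- The roles: N = n², K = 1/δ, D = twice the minimum degree, T = ∑ d, Q = ∑ d², k = the number
  -- of low link vertices and c = gap-scale².
  low-count-bound : ∀ c n N K D T Q k → 1 ≤ n → 1 ≤ K → n ≤ N →
    13 * (N * N) * (K * K) ≤ (6 * D * K + 6 * N + N * K) * (6 * D * K + 6 * N + N * K) →
    suc n * D + 3 * Q ≤ n * N + 3 * N + 3 * n + 1 →
    D ≤ T →
    k * (N * N) + 2 * c * ((n * D) * T) ≤ c * (N * Q + suc n * (D * D)) →
    D ≤ N + 2 * n + 1 →
    3 * k * K ≤ 55 * c * K + 28 * c * n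
  low-count-bound c n N K D T Q k 1≤n 1≤K n≤N cstar degree-sum D≤T deviation D≤m² =
    *-cancelʳ-≤ (3 * k * K) (55 * c * K + 28 * c * n) (N * N * K) ⦃ >-nonZero 0<N²K ⦄ (begin
      3 * k * K * (N * N * K)         ≡⟨ e₁ k N K ⟩
      3 * k * (N * N) * (K * K)       ≤⟨ 3kN²K²≤R ⟩
      R                               ≤⟨ R≤R′ ⟩
      R′                              ≡⟨ e₂ c n N K ⟩
      (55 * c * K + 28 * c * n) * (N * N * K) ∎)
    where
    open ≤-Reasoning
    m : ℕ
    m = suc n
    1≤N : 1 ≤ N
    1≤N = ≤-trans 1≤n n≤N
    0<N²K : 0 < N * N * K
    0<N²K = *-mono-≤ (*-mono-≤ 1≤N 1≤N) 1≤K
    e₁ : ∀ k N K → 3 * k * K * (N * N * K) ≡ 3 * k * (N * N) * (K * K)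
    e₁ = solve-∀
    e₂ : ∀ c n N K → c * N * (7 * N) * K * K + 3 * c * (4 * N) * (4 * N) * K * K + 3 * c * n * N * N * K
                     + 6 * c * n * (4 * N) * K * N + c * n * N * N * K
                   ≡ (55 * c * K + 28 * c * n) * (N * N * K)
    e₂ = solve-∀

    B : ℕ
    B = 3 * D * D * K * K + 3 * N * N + 6 * D * K * N + D * N * K * K + N * N * K
    -- Divided by K², this reads N² ≤ 3D² + DN + O(N²/K): c⋆ is the positive root of 1 − t − 3t².
    N²K²≤B : N * N * (K * K) ≤ B
    N²K²≤B = *-cancelˡ-≤ 12 (+-cancelˡ-≤ (N * N * (K * K)) _ _ (subst₂ _≤_ (e N K) (e′ N K D) cstar))
      where
      e : ∀ N K → 13 * (N * N) * (K * K) ≡ N * N * (K * K) + 12 * (N * N * (K * K))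
      e = solve-∀
      e′ : ∀ N K D → (6 * D * K + 6 * N + N * K) * (6 * D * K + 6 * N + N * K)
                     ≡ N * N * (K * K) + 12 * (3 * D * D * K * K + 3 * N * N + 6 * D * K * N + D * N * K * K + N * N * K)
      e′ = solve-∀

    deviation′ : k * (N * N) + 2 * c * ((n * D) * D) ≤ c * (N * Q + m * (D * D))
    deviation′ = ≤-trans (+-monoʳ-≤ (k * (N * N)) (*-monoʳ-≤ (2 * c) (*-monoʳ-≤ (n * D) D≤T))) deviation

    Q-eliminated : 3 * (k * (N * N) + 2 * c * ((n * D) * D)) + c * N * (m * D)
           ≤ c * N * (n * N + 3 * N + 3 * n + 1) + 3 * c * (m * (D * D))
    Q-eliminated = begin
      3 * (k * (N * N) + 2 * c * ((n * D) * D)) + c * N * (m * D)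
        ≤⟨ +-monoˡ-≤ (c * N * (m * D)) (*-monoʳ-≤ 3 deviation′) ⟩
      3 * (c * (N * Q + m * (D * D))) + c * N * (m * D)
        ≡⟨ e c n N D Q ⟩
      c * N * (m * D + 3 * Q) + 3 * c * (m * (D * D))
        ≤⟨ +-monoˡ-≤ (3 * c * (m * (D * D))) (*-monoʳ-≤ (c * N) degree-sum) ⟩
      c * N * (n * N + 3 * N + 3 * n + 1) + 3 * c * (m * (D * D)) ∎
      where
      e : ∀ c n N D Q → 3 * (c * (N * Q + suc n * (D * D))) + c * N * (suc n * D)
          ≡ c * N * (suc n * D + 3 * Q) + 3 * c * (suc n * (D * D))
      e = solve-∀

    C : ℕ
    C = 6 * c * n * D * D * K * K + c * n * N * D * K * K + c * n * N * N * K * K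
    R : ℕ
    R = c * N * (3 * N + 3 * n + 1) * K * K + 3 * c * D * D * K * K + 3 * c * n * N * N
        + 6 * c * n * D * K * N + c * n * N * N * K

    3kN²K²≤R : 3 * k * (N * N) * (K * K) ≤ R
    3kN²K²≤R = +-cancelʳ-≤ C _ _ (≤-trans (m≤m+n (3 * k * (N * N) * (K * K) + C) (c * N * D * K * K))
             (subst₂ _≤_ (eL c n N K D k) (eR c n N K D)
                     (+-mono-≤ (*-monoˡ-≤ (K * K) Q-eliminated) (*-monoʳ-≤ (c * n) N²K²≤B))))
      where
      eL : ∀ c n N K D k → (3 * (k * (N * N) + 2 * c * ((n * D) * D)) + c * N * (suc n * D)) * (K * K)
                           + c * n * (N * N * (K * K))
           ≡ 3 * k * (N * N) * (K * K) + (6 * c * n * D * D * K * K + c * n * N * D * K * K + c * n * N * N * K * K)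
             + c * N * D * K * K
      eL = solve-∀
      eR : ∀ c n N K D → (c * N * (n * N + 3 * N + 3 * n + 1) + 3 * c * (suc n * (D * D))) * (K * K)
                         + c * n * (3 * D * D * K * K + 3 * N * N + 6 * D * K * N + D * N * K * K + N * N * K)
           ≡ (c * N * (3 * N + 3 * n + 1) * K * K + 3 * c * D * D * K * K + 3 * c * n * N * N
              + 6 * c * n * D * K * N + c * n * N * N * K)
             + (6 * c * n * D * D * K * K + c * n * N * D * K * K + c * n * N * N * K * K)
      eR = solve-∀

    D≤4N : D ≤ 4 * N
    D≤4N = ≤-trans D≤m² (subst (N + 2 * n + 1 ≤_) (e N) (+-mono-≤ (+-monoʳ-≤ N (*-monoʳ-≤ 2 n≤N)) 1≤N))
      where
      e : ∀ N → N + 2 * N + N ≡ 4 * N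
      e = solve-∀
    ≤7N : 3 * N + 3 * n + 1 ≤ 7 * N
    ≤7N = subst (3 * N + 3 * n + 1 ≤_) (e N) (+-mono-≤ (+-monoʳ-≤ (3 * N) (*-monoʳ-≤ 3 n≤N)) 1≤N)
      where
      e : ∀ N → 3 * N + 3 * N + N ≡ 7 * N
      e = solve-∀

    R′ : ℕ
    R′ = c * N * (7 * N) * K * K + 3 * c * (4 * N) * (4 * N) * K * K + 3 * c * n * N * N * K
         + 6 * c * n * (4 * N) * K * N + c * n * N * N * K

    R≤R′ : R ≤ R′
    R≤R′ = +-mono-≤ (+-mono-≤ (+-mono-≤ (+-mono-≤
             (*-monoˡ-≤ K (*-monoˡ-≤ K (*-monoʳ-≤ (c * N) ≤7N)))
             (*-monoˡ-≤ K (*-monoˡ-≤ K (*-mono-≤ (*-monoʳ-≤ (3 * c) D≤4N) D≤4N))))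
             (subst (_≤ 3 * c * n * N * N * K) (*-identityʳ (3 * c * n * N * N)) (*-monoʳ-≤ (3 * c * n * N * N) 1≤K)))
             (*-monoˡ-≤ N (*-monoˡ-≤ K (*-monoʳ-≤ (6 * c * n) D≤4N))))
             ≤-refl

  dense-if-few-low : ∀ n dv h k → 100 ≤ n → 100 * k ≤ n → dv ≤ h + k → 21 * n ≤ 50 * dv → 2 * suc n < 5 * h
  dense-if-few-low n dv h k 100≤n 100k≤n dv≤h+k 21n≤50dv = *-cancelˡ-< 100 (2 * suc n) (5 * h) (begin-strict
    100 * (2 * suc n)        ≡⟨ e₁ n ⟩
    200 * n + 200            <⟨ +-monoʳ-< (200 * n) (≤-trans (m≤m+n 201 299) (*-monoʳ-≤ 5 100≤n)) ⟩
    200 * n + 5 * n          ≡⟨ e₂ n ⟩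
    205 * n                  ≤⟨ 205n≤500h ⟩
    500 * h                  ≡⟨ e₃ h ⟩
    100 * (5 * h)            ∎)
    where
    open ≤-Reasoning
    e₁ : ∀ n → 100 * (2 * suc n) ≡ 200 * n + 200
    e₁ = solve-∀
    e₂ : ∀ n → 200 * n + 5 * n ≡ 205 * n
    e₂ = solve-∀
    e₃ : ∀ h → 500 * h ≡ 100 * (5 * h)
    e₃ = solve-∀
    e₄ : ∀ n → 205 * n + 5 * n ≡ 10 * (21 * n)
    e₄ = solve-∀
    e₅ : ∀ h k → 10 * (50 * (h + k)) ≡ 500 * h + 5 * (100 * k)
    e₅ = solve-∀
    205n≤500h : 205 * n ≤ 500 * h
    205n≤500h = +-cancelʳ-≤ (5 * n) (205 * n) (500 * h) (begin
      205 * n + 5 * n                    ≡⟨ e₄ n ⟩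
      10 * (21 * n)                      ≤⟨ *-monoʳ-≤ 10 (≤-trans 21n≤50dv (*-monoʳ-≤ 50 dv≤h+k)) ⟩
      10 * (50 * (h + k))                ≡⟨ e₅ h k ⟩
      500 * h + 5 * (100 * k)            ≤⟨ +-monoʳ-≤ (500 * h) (*-monoʳ-≤ 5 100k≤n) ⟩
      500 * h + 5 * n                    ∎)

  low-count-for-large-n : ∀ s q n k → 1 ≤ s → 100 ≤ n → 5000 * (s * s) * q ≤ n →
    3 * k * suc (2000 * (s * s) * q) ≤ 55 * (s * s) * suc (2000 * (s * s) * q) + 28 * (s * s) * n → 100 * q * k ≤ n
  low-count-for-large-n s q n k 1≤s 100≤n n₀≤n bound = *-cancelˡ-≤ (60 * (s * s)) ⦃ >-nonZero 0<60s² ⦄ (begin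
    60 * (s * s) * (100 * q * k)                            ≡⟨ e₁ s q k ⟩
    3 * k * (2000 * (s * s) * q)                            ≤⟨ *-monoʳ-≤ (3 * k) (n≤1+n _) ⟩
    3 * k * suc (2000 * (s * s) * q)                        ≤⟨ bound ⟩
    55 * (s * s) * suc (2000 * (s * s) * q) + 28 * (s * s) * n ≡⟨ e₂ s q n ⟩
    55 * (s * s) + 22 * (s * s) * (5000 * (s * s) * q) + 28 * (s * s) * n
      ≤⟨ +-monoˡ-≤ (28 * (s * s) * n) (+-mono-≤ (*-monoˡ-≤ (s * s) (≤-trans (m≤m+n 55 945) (*-monoʳ-≤ 10 100≤n)))
                                                (*-monoʳ-≤ (22 * (s * s)) n₀≤n)) ⟩
    10 * n * (s * s) + 22 * (s * s) * n + 28 * (s * s) * n  ≡⟨ e₃ s n ⟩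
    60 * (s * s) * n                                        ∎)
    where
    open ≤-Reasoning
    0<60s² : 0 < 60 * (s * s)
    0<60s² = ≤-trans (s≤s z≤n) (*-monoʳ-≤ 60 (*-mono-≤ 1≤s 1≤s))
    e₁ : ∀ s q k → 60 * (s * s) * (100 * q * k) ≡ 3 * k * (2000 * (s * s) * q)
    e₁ = solve-∀
    e₂ : ∀ s q n → 55 * (s * s) * suc (2000 * (s * s) * q) + 28 * (s * s) * n
                   ≡ 55 * (s * s) + 22 * (s * s) * (5000 * (s * s) * q) + 28 * (s * s) * n
    e₂ = solve-∀
    e₃ : ∀ s n → 10 * n * (s * s) + 22 * (s * s) * n + 28 * (s * s) * n ≡ 60 * (s * s) * n
    e₃ = solve-∀

  removed-edges-bound : ∀ n q k → 1 ≤ n → 100 * q * k ≤ n → 2 * (suc n * k) * q ≤ n * n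
  removed-edges-bound n q k 1≤n 100qk≤n = begin
    2 * (suc n * k) * q       ≡⟨ e₁ n q k ⟩
    (2 * n + 2) * (q * k)     ≤⟨ *-monoˡ-≤ (q * k) (+-monoʳ-≤ (2 * n) (*-monoʳ-≤ 2 1≤n)) ⟩
    (2 * n + 2 * n) * (q * k) ≤⟨ *-monoˡ-≤ (q * k) (≤-trans (≤-reflexive (e₂ n)) (*-monoˡ-≤ n (m≤m+n 4 96))) ⟩
    100 * n * (q * k)         ≡⟨ e₃ n q k ⟩
    n * (100 * q * k)         ≤⟨ *-monoʳ-≤ n 100qk≤n ⟩
    n * n                     ∎
    where
    open ≤-Reasoning
    e₁ : ∀ n q k → 2 * (suc n * k) * q ≡ (2 * n + 2) * (q * k)
    e₁ = solve-∀
    e₂ : ∀ n → 2 * n + 2 * n ≡ 4 * n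
    e₂ = solve-∀
    e₃ : ∀ n q k → 100 * n * (q * k) ≡ n * (100 * q * k)
    e₃ = solve-∀

  -- The link of a vertex in no K₄⁽³⁾⁻

  module K4⁻-free-vertex {m : ℕ} (H : ThreeGraph m) (x : Fin m) (x∉K4⁻ : NotInK4minus H x) where

    E : Fin m → Fin m → Fin m → Bool
    E = edge H

    G : Fin m → Fin m → Bool
    G = link H x

    g : Fin m → Fin m → ℕ
    g y z = b2n (G y z)

    d : Fin m → ℕ
    d y = sum (g y)

    edge⇒≢₁₂ : ∀ {a b c} → E a b c ≡ true → a ≢ b
    edge⇒≢₁₂ e = proj₁ (distinct H _ _ _ e)

    edge⇒≢₂₃ : ∀ {a b c} → E a b c ≡ true → b ≢ c
    edge⇒≢₂₃ e = proj₁ (proj₂ (distinct H _ _ _ e))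

    edge⇒≢₁₃ : ∀ {a b c} → E a b c ≡ true → a ≢ c
    edge⇒≢₁₃ e = proj₂ (proj₂ (distinct H _ _ _ e))

    E-rotate : ∀ a b c → E a b c ≡ E c a b
    E-rotate a b c = trans (sym₂₃ H a b c) (sym₁₂ H a c b)

    E-irrefl : ∀ a b → E a b b ≡ false
    E-irrefl a b with E a b b in e
    ... | true  = ⊥-elim (edge⇒≢₂₃ e refl)
    ... | false = refl

    G-sym : ∀ y z → G y z ≡ G z y
    G-sym = sym₂₃ H x

    g-sym : ∀ y z → g y z ≡ g z y
    g-sym y z = cong b2n (G-sym y z)

    G-irrefl : ∀ y → G y y ≡ false
    G-irrefl = E-irrefl x

    link-triangle-free : ∀ y z w → G y z ≡ true → G y w ≡ true → G z w ≡ true → ⊥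
    link-triangle-free y z w xyz xyw xzw = x∉K4⁻ y z w
      ( edge⇒≢₁₂ xyz , edge⇒≢₁₃ xyz , edge⇒≢₁₃ xyw
      , edge⇒≢₂₃ xyz , edge⇒≢₂₃ xyw , edge⇒≢₂₃ xzw
      , ≤-trans (three-true xyz xyw xzw) (m≤m+n _ _))

    link-cherry-not-edge : ∀ c a b → G c a ≡ true → G c b ≡ true → E c a b ≡ true → ⊥
    link-cherry-not-edge c a b xca xcb cab = x∉K4⁻ c a b
      ( edge⇒≢₁₂ xca , edge⇒≢₁₃ xca , edge⇒≢₁₃ xcb
      , edge⇒≢₂₃ xca , edge⇒≢₂₃ xcb , edge⇒≢₂₃ cab
      , ≤-trans (three-true xca xcb cab) (+-monoˡ-≤ (b2n (E c a b)) (m≤m+n _ (b2n (E x a b)))))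

    link-weight : ∀ y z w → b2n (E y z w) + b2n (G y w ∧ G z w) + g y z * (g y w + g z w) ≤ 1
    link-weight y z w = link-weight-≤1 (G y z) (G y w) (G z w) (E y z w)
      (link-triangle-free y z w)
      (link-cherry-not-edge y z w)
      (λ yw zw yzw → link-cherry-not-edge w y z (trans (G-sym w y) yw) (trans (G-sym w z) zw)
                                               (trans (sym (E-rotate y z w)) yzw))
      (λ yz zw yzw → link-cherry-not-edge z y w (trans (G-sym z y) yz) zw (trans (sym₁₂ H z y w) yzw))

    codegree : Fin m → Fin m → ℕ
    codegree y z = sum (λ w → b2n (E y z w))

    link-codegree : Fin m → Fin m → ℕ
    link-codegree y z = sum (λ w → b2n (G y w ∧ G z w))

    neighbour-degree-sum : Fin m → ℕ
    neighbour-degree-sum y = sum (λ w → g y w * d w)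

    degree-square-sum : ℕ
    degree-square-sum = sum (λ y → d y * d y)

    pair-bound : ∀ y z → codegree y z + link-codegree y z + g y z * (d y + d z) ≤ m
    pair-bound y z = begin
      codegree y z + link-codegree y z + g y z * (d y + d z)
        ≡⟨ cong (codegree y z + link-codegree y z +_) (cong (g y z *_) (∑-distrib-+ (g y) (g z))) ⟨
      codegree y z + link-codegree y z + g y z * sum (λ w → g y w + g z w)
        ≡⟨ cong (codegree y z + link-codegree y z +_) (*-distribˡ-sum (g y z) (λ w → g y w + g z w)) ⟩
      codegree y z + link-codegree y z + sum (λ w → g y z * (g y w + g z w))
        ≡⟨ ∑-distrib-+₃ (λ w → b2n (E y z w)) (λ w → b2n (G y w ∧ G z w)) (λ w → g y z * (g y w + g z w)) ⟨
      sum (λ w → b2n (E y z w) + b2n (G y w ∧ G z w) + g y z * (g y w + g z w))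
        ≤⟨ sum-mono-≤ (link-weight y z) ⟩
      sum {m} (λ _ → 1)                                        ≡⟨ sum-const m 1 ⟩
      m * 1                                                    ≡⟨ *-identityʳ m ⟩
      m                                                        ∎
      where open ≤-Reasoning

    ∑-codegree : ∀ y → sum (codegree y) ≡ 2 * degree H y
    ∑-codegree y = sym (double-countPairs (E y) (sym₂₃ H y) (E-irrefl y))

    ∑-link-codegree : ∀ y → sum (link-codegree y) ≡ neighbour-degree-sum y
    ∑-link-codegree y = begin
      sum (λ z → sum (λ w → b2n (G y w ∧ G z w)))
        ≡⟨ sum-cong-≗ (λ z → sum-cong-≗ (λ w → b2n-∧ (G y w) (G z w))) ⟩
      sum (λ z → sum (λ w → g y w * g z w))       ≡⟨ ∑-comm (λ z w → g y w * g z w) ⟩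
      sum (λ w → sum (λ z → g y w * g z w))       ≡⟨ sum-cong-≗ (λ w → *-distribˡ-sum (g y w) (λ z → g z w)) ⟨
      sum (λ w → g y w * sum (λ z → g z w))
        ≡⟨ sum-cong-≗ (λ w → cong (g y w *_) (sum-cong-≗ (λ z → g-sym z w))) ⟩
      neighbour-degree-sum y                      ∎
      where open ≡-Reasoning

    ∑-link-weight : ∀ y → sum (λ z → g y z * (d y + d z)) ≡ d y * d y + neighbour-degree-sum y
    ∑-link-weight y = begin
      sum (λ z → g y z * (d y + d z))              ≡⟨ sum-cong-≗ (λ z → *-distribˡ-+ (g y z) (d y) (d z)) ⟩
      sum (λ z → g y z * d y + g y z * d z)        ≡⟨ ∑-distrib-+ (λ z → g y z * d y) (λ z → g y z * d z) ⟩
      sum (λ z → g y z * d y) + neighbour-degree-sum y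
        ≡⟨ cong (_+ neighbour-degree-sum y) (*-distribʳ-sum (d y) (g y)) ⟨
      d y * d y + neighbour-degree-sum y           ∎
      where open ≡-Reasoning

    vertex-bound : ∀ y → 2 * degree H y + neighbour-degree-sum y + (d y * d y + neighbour-degree-sum y) ≤ m * m
    vertex-bound y = begin
      2 * degree H y + neighbour-degree-sum y + (d y * d y + neighbour-degree-sum y)
        ≡⟨ cong₂ _+_ (cong₂ _+_ (∑-codegree y) (∑-link-codegree y)) (∑-link-weight y) ⟨
      sum (codegree y) + sum (link-codegree y) + sum (λ z → g y z * (d y + d z))
        ≡⟨ ∑-distrib-+₃ (codegree y) (link-codegree y) (λ z → g y z * (d y + d z)) ⟨
      sum (λ z → codegree y z + link-codegree y z + g y z * (d y + d z))
        ≤⟨ sum-mono-≤ (pair-bound y) ⟩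
      sum {m} (λ _ → m)                            ≡⟨ sum-const m m ⟩
      m * m                                        ∎
      where open ≤-Reasoning

    ∑-neighbour-degree-sum : sum neighbour-degree-sum ≡ degree-square-sum
    ∑-neighbour-degree-sum = begin
      sum (λ y → sum (λ w → g y w * d w))          ≡⟨ ∑-comm (λ y w → g y w * d w) ⟩
      sum (λ w → sum (λ y → g y w * d w))          ≡⟨ sum-cong-≗ (λ w → *-distribʳ-sum (d w) (λ y → g y w)) ⟨
      sum (λ w → sum (λ y → g y w) * d w)
        ≡⟨ sum-cong-≗ (λ w → cong (_* d w) (sum-cong-≗ (λ y → g-sym y w))) ⟩
      degree-square-sum                            ∎
      where open ≡-Reasoning

    degree-sum-bound : sum (λ y → 2 * degree H y) + 3 * degree-square-sum ≤ m * (m * m)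
    degree-sum-bound = begin
      sum (λ y → 2 * degree H y) + 3 * Q
        ≡⟨ regroup (sum (λ y → 2 * degree H y)) Q ⟩
      sum (λ y → 2 * degree H y) + Q + (Q + Q)
        ≡⟨ cong₂ (λ a b → sum (λ y → 2 * degree H y) + a + (sum (λ y → d y * d y) + b))
                 ∑-neighbour-degree-sum ∑-neighbour-degree-sum ⟨
      sum (λ y → 2 * degree H y) + sum neighbour-degree-sum + (sum (λ y → d y * d y) + sum neighbour-degree-sum)
        ≡⟨ cong (sum (λ y → 2 * degree H y) + sum neighbour-degree-sum +_)
                (∑-distrib-+ (λ y → d y * d y) neighbour-degree-sum) ⟨
      sum (λ y → 2 * degree H y) + sum neighbour-degree-sum + sum (λ y → d y * d y + neighbour-degree-sum y)
        ≡⟨ ∑-distrib-+₃ (λ y → 2 * degree H y) neighbour-degree-sum (λ y → d y * d y + neighbour-degree-sum y) ⟨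
      sum (λ y → 2 * degree H y + neighbour-degree-sum y + (d y * d y + neighbour-degree-sum y))
        ≤⟨ sum-mono-≤ vertex-bound ⟩
      sum {m} (λ _ → m * m)                        ≡⟨ sum-const m (m * m) ⟩
      m * (m * m)                                  ∎
      where
      open ≤-Reasoning
      Q : ℕ
      Q = degree-square-sum
      regroup : ∀ a Q → a + 3 * Q ≡ a + Q + (Q + Q)
      regroup = solve-∀

    ∑-link-degree : sum d ≡ 2 * degree H x
    ∑-link-degree = sym (double-countPairs G G-sym G-irrefl)


    low-link-degree : ℕ → Fin m → Bool
    low-link-degree n y = 50 * d y <ᵇ 21 * n

    deviation-bound : ∀ r n D (low : Fin m → Bool) → 1 ≤ r →
      (∀ y → low y ≡ true → r * (n * d y) + n * n ≤ r * D) →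
      sum (b2n ∘ low) * ((n * n) * (n * n)) + 2 * (r * r) * ((n * D) * sum d)
        ≤ (r * r) * ((n * n) * degree-square-sum + m * (D * D))
    deviation-bound r n D low 1≤r gap = begin
      sum (b2n ∘ low) * (N * N) + 2 * (r * r) * ((n * D) * sum d)
        ≡⟨ cong₂ _+_ (*-distribʳ-sum (N * N) (b2n ∘ low))
                     (trans (cong (2 * (r * r) *_) (*-distribˡ-sum (n * D) d))
                            (*-distribˡ-sum (2 * (r * r)) (λ y → (n * D) * d y))) ⟩
      sum (λ y → b2n (low y) * (N * N)) + sum (λ y → 2 * (r * r) * ((n * D) * d y))
        ≡⟨ ∑-distrib-+ (λ y → b2n (low y) * (N * N)) (λ y → 2 * (r * r) * ((n * D) * d y)) ⟨
      sum (λ y → b2n (low y) * (N * N) + 2 * (r * r) * ((n * D) * d y))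
        ≤⟨ sum-mono-≤ (λ y → squared-deviation r n D (d y) 1≤r (low y) (gap y)) ⟩
      sum (λ y → (r * r) * (N * (d y * d y) + D * D))
        ≡⟨ *-distribˡ-sum (r * r) (λ y → N * (d y * d y) + D * D) ⟨
      (r * r) * sum (λ y → N * (d y * d y) + D * D)
        ≡⟨ cong (r * r *_) (trans (∑-distrib-+ (λ y → N * (d y * d y)) (λ _ → D * D))
                                  (cong₂ _+_ (sym (*-distribˡ-sum N (λ y → d y * d y))) (sum-const m (D * D)))) ⟩
      (r * r) * (N * degree-square-sum + m * (D * D)) ∎
      where
      open ≤-Reasoning
      N : ℕ
      N = n * n

  -- Removing the link edges at low vertices

  module Bipartite-off-low {m : ℕ} (G : Fin m → Fin m → Bool) (G-sym : ∀ y z → G y z ≡ G z y)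
    (triangle-free : ∀ y z w → G y z ≡ true → G y w ≡ true → G z w ≡ true → ⊥)
    (low : Fin m → Bool) where

    g : Fin m → Fin m → ℕ
    g y z = b2n (G y z)

    high-degree : Fin m → ℕ
    high-degree v = sum (λ w → b2n (not (low w)) * g v w)

    #low : ℕ
    #low = sum (b2n ∘ low)

    degree≤high-degree+#low : ∀ v → sum (g v) ≤ high-degree v + #low
    degree≤high-degree+#low v =
      ≤-trans (sum-mono-≤ split) (≤-reflexive (∑-distrib-+ (λ w → b2n (not (low w)) * g v w) (b2n ∘ low)))
      where
      split : ∀ w → g v w ≤ b2n (not (low w)) * g v w + b2n (low w)
      split w with low w | G v w
      ... | true  | true  = ≤-refl
      ... | true  | false = z≤n
      ... | false | _     = ≤-reflexive (sym (trans (+-identityʳ _) (+-identityʳ _)))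

    at-low : Fin m → Fin m → Bool
    at-low y z = G y z ∧ (low y ∨ low z)

    at-low⊆G : ∀ y z → at-low y z ≡ true → G y z ≡ true
    at-low⊆G y z e with G y z
    ... | true = refl

    countPairs-at-low : countPairs at-low ≤ 2 * (m * #low)
    countPairs-at-low = begin
      countPairs at-low
        ≡⟨ countPairs-∑ at-low ⟩
      sum (λ y → sum (λ z → b2n ((toℕ y <ᵇ toℕ z) ∧ at-low y z)))
        ≤⟨ sum-mono-≤ (λ y → sum-mono-≤ (λ z → at-low-weight (toℕ y <ᵇ toℕ z) (G y z) (low y) (low z))) ⟩
      sum (λ y → sum (λ z → b2n (low y) + b2n (low z)))
        ≡⟨ sum-cong-≗ (λ y → ∑-distrib-+ {m} (λ _ → b2n (low y)) (b2n ∘ low)) ⟩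
      sum (λ y → sum {m} (λ _ → b2n (low y)) + #low)
        ≡⟨ sum-cong-≗ (λ y → cong (_+ #low) (sum-const m (b2n (low y)))) ⟩
      sum (λ y → m * b2n (low y) + #low)
        ≡⟨ ∑-distrib-+ (λ y → m * b2n (low y)) (λ _ → #low) ⟩
      sum (λ y → m * b2n (low y)) + sum {m} (λ _ → #low)
        ≡⟨ cong₂ _+_ (*-distribˡ-sum m (b2n ∘ low)) (sym (sum-const m #low)) ⟨
      m * #low + m * #low
        ≡⟨ cong (m * #low +_) (+-identityʳ (m * #low)) ⟨
      2 * (m * #low)
        ∎
      where
      open ≤-Reasoning
      at-low-weight : ∀ c e a b → b2n (c ∧ (e ∧ (a ∨ b))) ≤ b2n a + b2n b
      at-low-weight false _    _     _     = z≤n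
      at-low-weight true  false _    _     = z≤n
      at-low-weight true  true  true  _    = s≤s z≤n
      at-low-weight true  true  false true = s≤s z≤n
      at-low-weight true  true  false false = z≤n

    module _ (dense : ∀ v → low v ≡ false → 2 * m < 5 * high-degree v) where

      ¬crowded : ∀ {j} c (vs : Fin (suc j) → Fin m) → (∀ i → low (vs i) ≡ false) →
        (∀ w → low w ≡ false → sum (λ i → g (vs i) w) ≤ c) → 5 * c ≤ 2 * suc j → ⊥
      ¬crowded {j} c vs vs-high c-bound 5c≤2J = <⇒≱ many few
        where
        J : ℕ
        J = suc j
        open ≤-Reasoning
        few : 5 * sum (high-degree ∘ vs) ≤ J * (2 * m)
        few = begin
          5 * sum (λ i → sum (λ w → b2n (not (low w)) * g (vs i) w))
            ≡⟨ cong (5 *_) (∑-comm (λ i w → b2n (not (low w)) * g (vs i) w)) ⟩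
          5 * sum (λ w → sum (λ i → b2n (not (low w)) * g (vs i) w))
            ≡⟨ cong (5 *_) (sum-cong-≗ (λ w → *-distribˡ-sum (b2n (not (low w))) (λ i → g (vs i) w))) ⟨
          5 * sum (λ w → b2n (not (low w)) * sum (λ i → g (vs i) w))
            ≤⟨ *-monoʳ-≤ 5 (sum-mono-≤ (λ w → high-weight-≤ (low w) (c-bound w))) ⟩
          5 * sum {m} (λ _ → c)      ≡⟨ cong (5 *_) (sum-const m c) ⟩
          5 * (m * c)                ≡⟨ e₁ m c ⟩
          m * (5 * c)                ≤⟨ *-monoʳ-≤ m 5c≤2J ⟩
          m * (2 * J)                ≡⟨ e₂ m J ⟩
          J * (2 * m)                ∎
          where
          e₁ : ∀ m c → 5 * (m * c) ≡ m * (5 * c)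
          e₁ = solve-∀
          e₂ : ∀ m J → m * (2 * J) ≡ J * (2 * m)
          e₂ = solve-∀
        many : J * (2 * m) < 5 * sum (high-degree ∘ vs)
        many = begin-strict
          J * (2 * m)                       <⟨ *-monoʳ-< J (n<1+n (2 * m)) ⟩
          J * suc (2 * m)                   ≡⟨ sum-const J (suc (2 * m)) ⟨
          sum {J} (λ _ → suc (2 * m))       ≤⟨ sum-mono-≤ (λ i → dense (vs i) (vs-high i)) ⟩
          sum (λ i → 5 * high-degree (vs i)) ≡⟨ *-distribˡ-sum 5 (high-degree ∘ vs) ⟨
          5 * sum (high-degree ∘ vs)         ∎

      no-high-C₅ : ∀ v₀ v₁ v₂ v₃ v₄ →
        G v₀ v₁ ≡ true → G v₁ v₂ ≡ true → G v₂ v₃ ≡ true → G v₃ v₄ ≡ true → G v₄ v₀ ≡ true →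
        low v₀ ≡ false → low v₁ ≡ false → low v₂ ≡ false → low v₃ ≡ false → low v₄ ≡ false → ⊥
      no-high-C₅ v₀ v₁ v₂ v₃ v₄ e₀₁ e₁₂ e₂₃ e₃₄ e₄₀ l₀ l₁ l₂ l₃ l₄ =
        ¬crowded {4} 2 (λ { 0F → v₀ ; 1F → v₁ ; 2F → v₂ ; 3F → v₃ ; 4F → v₄ })
                       (λ { 0F → l₀ ; 1F → l₁ ; 2F → l₂ ; 3F → l₃ ; 4F → l₄ })
                       (λ w _ → C₅-independent (G v₀ w) (G v₁ w) (G v₂ w) (G v₃ w) (G v₄ w)
                                  (triangle-free v₀ v₁ w e₀₁) (triangle-free v₁ v₂ w e₁₂)
                                  (triangle-free v₂ v₃ w e₂₃) (triangle-free v₃ v₄ w e₃₄)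
                                  (triangle-free v₄ v₀ w e₄₀))
                       ≤-refl

      module _ (u : Fin m) (u-high : low u ≡ false) where

        Joins : Fin m → Fin m → Set
        Joins w a = (low a ≡ false) × (G u a ≡ true) × (G a w ≡ true)

        joins? : ∀ w a → Dec (Joins w a)
        joins? w a = (low a Bool.≟ false) ×-dec ((G u a Bool.≟ true) ×-dec (G a w Bool.≟ true))

        colour : Fin m → Bool
        colour w = isYes (any? (joins? w))

        colour-true : ∀ {w} → colour w ≡ true → ∃[ a ] Joins w a
        colour-true {w} eq = toWitness {a? = any? (joins? w)} (Equivalence.from T-≡ eq)

        colour-false : ∀ {w} → colour w ≡ false → ∀ a → ¬ Joins w a
        colour-false {w} eq a j = toWitnessFalse {a? = any? (joins? w)} (Equivalence.from T-not-≡ eq) (a , j)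

        no-true-edge : ∀ y z → G y z ≡ true → low y ≡ false → low z ≡ false →
          colour y ≡ true → colour z ≡ true → ⊥
        no-true-edge y z eyz ly lz cy cz with colour-true cy | colour-true cz
        ... | a , la , eua , eay | b , lb , eub , ebz =
          no-high-C₅ u a y z b eua eay eyz (trans (G-sym z b) ebz) (trans (G-sym b u) eub) u-high la ly lz lb

        no-false-edge : ∀ y z → G y z ≡ true → low y ≡ false → low z ≡ false →
          colour y ≡ false → colour z ≡ false → ⊥
        no-false-edge y z eyz ly lz cy cz =
          ¬crowded {2} 1 (λ { 0F → u ; 1F → y ; 2F → z })
                         (λ { 0F → u-high ; 1F → ly ; 2F → lz })
                         (λ w lw → K₃-independent (G u w) (G y w) (G z w)
                                     (λ euw eyw → colour-false cy w (lw , euw , trans (G-sym w y) eyw))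
                                     (triangle-free y z w eyz)
                                     (λ euw ezw → colour-false cz w (lw , euw , trans (G-sym w z) ezw)))
                         (n≤1+n 5)

        colour-proper : ∀ y z → toℕ y < toℕ z → (G minus at-low) y z ≡ true → colour y ≢ colour z
        colour-proper y z _ e with minus-true (at-low y z) (G y z) e
        ... | off-low , eyz = booleans-differ (no-true-edge y z eyz ly lz) (no-false-edge y z eyz ly lz)
          where
          both-high : (low y ∨ low z) ≡ false
          both-high = subst (λ t → t ∧ (low y ∨ low z) ≡ false) eyz off-low
          ly : low y ≡ false
          ly = ∨-conicalˡ (low y) (low z) both-high
          lz : low z ≡ false
          lz = ∨-conicalʳ (low y) (low z) both-high

        bipartite : Bipartite (G minus at-low)
        bipartite = colour , colour-proper

  -- Rational bounds

  ℕtoℚ≡mkℚ : ∀ k → ℕtoℚ k ≡ ℚ.mkℚ (ℤ.+ k) 0 (Coprime.sym (Coprime.1-coprimeTo k))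
  ℕtoℚ≡mkℚ k = ℚ.normalize-coprime (Coprime.sym (Coprime.1-coprimeTo k))

  ℕtoℚ-+ : ∀ a b → ℕtoℚ (a + b) ≡ ℕtoℚ a ℚ.+ ℕtoℚ b
  ℕtoℚ-+ a b rewrite ℕtoℚ≡mkℚ a | ℕtoℚ≡mkℚ b =
    cong (ℚ._/ 1) (trans (ℤ.pos-+ a b) (sym (cong₂ ℤ._+_ (ℤ.*-identityʳ (ℤ.+ a)) (ℤ.*-identityʳ (ℤ.+ b)))))

  ℕtoℚ-* : ∀ a b → ℕtoℚ (a * b) ≡ ℕtoℚ a ℚ.* ℕtoℚ b
  ℕtoℚ-* a b rewrite ℕtoℚ≡mkℚ a | ℕtoℚ≡mkℚ b = cong (ℚ._/ 1) (ℤ.pos-* a b)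

  ℕtoℚ-mono-≤ : ∀ {a b} → a ≤ b → ℕtoℚ a ℚ.≤ ℕtoℚ b
  ℕtoℚ-mono-≤ {a} {b} a≤b rewrite ℕtoℚ≡mkℚ a | ℕtoℚ≡mkℚ b =
    ℚ.*≤* (subst₂ ℤ._≤_ (sym (ℤ.*-identityʳ (ℤ.+ a))) (sym (ℤ.*-identityʳ (ℤ.+ b))) (ℤ.+≤+ a≤b))

  ℕtoℚ-cancel-≤ : ∀ {a b} → ℕtoℚ a ℚ.≤ ℕtoℚ b → a ≤ b
  ℕtoℚ-cancel-≤ {a} {b} le rewrite ℕtoℚ≡mkℚ a | ℕtoℚ≡mkℚ b with le
  ... | ℚ.*≤* le′ = ℤ.drop‿+≤+ (subst₂ ℤ._≤_ (ℤ.*-identityʳ (ℤ.+ a)) (ℤ.*-identityʳ (ℤ.+ b)) le′)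

  ℕtoℚ-nonNeg : ∀ k → ℚ.NonNegative (ℕtoℚ k)
  ℕtoℚ-nonNeg k rewrite ℕtoℚ≡mkℚ k = _

  1/suc : ℕ → ℚ
  1/suc k = ℚ.mkℚ (ℤ.+ 1) k (Coprime.1-coprimeTo (suc k))

  1/suc-positive : ∀ k → ℚ.0ℚ ℚ.< 1/suc k
  1/suc-positive k = ℚ.*<* (ℤ.+<+ (s≤s z≤n))

  1/suc-inverse : ∀ k → 1/suc k ℚ.* ℕtoℚ (suc k) ≡ ℚ.1ℚ
  1/suc-inverse k rewrite ℕtoℚ≡mkℚ (suc k) =
    ℚ.*-inverseˡ (ℚ.mkℚ (ℤ.+ suc k) 0 (Coprime.sym (Coprime.1-coprimeTo (suc k))))

  min-degree-cstar-bound : ∀ K′ N D →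
    CStarTimes ℕtoℚ N ≤ (ℕtoℚ D ℚ.+ 1/suc K′ ℚ.* ℕtoℚ N) →
    13 * (N * N) * (suc K′ * suc K′) ≤ (6 * D * suc K′ + 6 * N + N * suc K′) * (6 * D * suc K′ + 6 * N + N * suc K′)
  min-degree-cstar-bound K′ N D (_ , 13N²≤Y²) =
    ℕtoℚ-cancel-≤ (subst₂ ℚ._≤_ (sym lhs) (sym rhs)
                           (ℚ.*-monoʳ-≤-nonNeg (ℕtoℚ (K * K)) ⦃ ℕtoℚ-nonNeg (K * K) ⦄ 13N²≤Y²))
    where
    open ≡-Reasoning
    K : ℕ
    K = suc K′
    κ : ℚ
    κ = ℕtoℚ K
    δ : ℚ
    δ = 1/suc K′
    ν : ℚ
    ν = ℕtoℚ N
    six : ℚ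
    six = ℕtoℚ 6
    Y : ℚ
    Y = six ℚ.* (ℕtoℚ D ℚ.+ δ ℚ.* ν) ℚ.+ ν
    X : ℕ
    X = 6 * D * K + 6 * N + N * K
    lhs : ℕtoℚ (13 * (N * N) * (K * K)) ≡ ℕtoℚ 13 ℚ.* (ν ℚ.* ν) ℚ.* ℕtoℚ (K * K)
    lhs = begin
      ℕtoℚ (13 * (N * N) * (K * K))                ≡⟨ ℕtoℚ-* (13 * (N * N)) (K * K) ⟩
      ℕtoℚ (13 * (N * N)) ℚ.* ℕtoℚ (K * K)         ≡⟨ cong (ℚ._* ℕtoℚ (K * K)) (ℕtoℚ-* 13 (N * N)) ⟩
      ℕtoℚ 13 ℚ.* ℕtoℚ (N * N) ℚ.* ℕtoℚ (K * K)
        ≡⟨ cong (λ t → ℕtoℚ 13 ℚ.* t ℚ.* ℕtoℚ (K * K)) (ℕtoℚ-* N N) ⟩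
      ℕtoℚ 13 ℚ.* (ν ℚ.* ν) ℚ.* ℕtoℚ (K * K)       ∎
    X≡ : ℕtoℚ X ≡ six ℚ.* ℕtoℚ D ℚ.* κ ℚ.+ six ℚ.* ν ℚ.* (δ ℚ.* κ) ℚ.+ ν ℚ.* κ
    X≡ = begin
      ℕtoℚ (6 * D * K + 6 * N + N * K)
        ≡⟨ trans (ℕtoℚ-+ (6 * D * K + 6 * N) (N * K)) (cong (ℚ._+ ℕtoℚ (N * K)) (ℕtoℚ-+ (6 * D * K) (6 * N))) ⟩
      ℕtoℚ (6 * D * K) ℚ.+ ℕtoℚ (6 * N) ℚ.+ ℕtoℚ (N * K)
        ≡⟨ cong₂ (λ a b → a ℚ.+ b ℚ.+ ℕtoℚ (N * K)) (trans (ℕtoℚ-* (6 * D) K) (cong (ℚ._* κ) (ℕtoℚ-* 6 D)))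
                                                     (ℕtoℚ-* 6 N) ⟩
      six ℚ.* ℕtoℚ D ℚ.* κ ℚ.+ six ℚ.* ν ℚ.+ ℕtoℚ (N * K)
        ≡⟨ cong₂ (λ a b → six ℚ.* ℕtoℚ D ℚ.* κ ℚ.+ a ℚ.+ b)
                 (sym (trans (cong (six ℚ.* ν ℚ.*_) (1/suc-inverse K′)) (ℚ.*-identityʳ (six ℚ.* ν))))
                 (ℕtoℚ-* N K) ⟩
      six ℚ.* ℕtoℚ D ℚ.* κ ℚ.+ six ℚ.* ν ℚ.* (δ ℚ.* κ) ℚ.+ ν ℚ.* κ ∎
    rhs : ℕtoℚ (X * X) ≡ Y ℚ.* Y ℚ.* ℕtoℚ (K * K)
    rhs = begin
      ℕtoℚ (X * X)                   ≡⟨ trans (ℕtoℚ-* X X) (cong₂ ℚ._*_ X≡ X≡) ⟩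
      _                              ≡⟨ scale six (ℕtoℚ D) δ ν κ ⟨
      Y ℚ.* Y ℚ.* (κ ℚ.* κ)          ≡⟨ cong (Y ℚ.* Y ℚ.*_) (ℕtoℚ-* K K) ⟨
      Y ℚ.* Y ℚ.* ℕtoℚ (K * K)       ∎
      where
      open ℚ-Solver.+-*-Solver
      scale : ∀ six D δ ν κ →
        ((six ℚ.* (D ℚ.+ δ ℚ.* ν) ℚ.+ ν) ℚ.* (six ℚ.* (D ℚ.+ δ ℚ.* ν) ℚ.+ ν)) ℚ.* (κ ℚ.* κ)
        ≡ (six ℚ.* D ℚ.* κ ℚ.+ six ℚ.* ν ℚ.* (δ ℚ.* κ) ℚ.+ ν ℚ.* κ)
          ℚ.* (six ℚ.* D ℚ.* κ ℚ.+ six ℚ.* ν ℚ.* (δ ℚ.* κ) ℚ.+ ν ℚ.* κ)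
      scale = solve 5 (λ six D δ ν κ →
        ((six :* (D :+ δ :* ν) :+ ν) :* (six :* (D :+ δ :* ν) :+ ν)) :* (κ :* κ)
        := (six :* D :* κ :+ six :* ν :* (δ :* κ) :+ ν :* κ) :* (six :* D :* κ :+ six :* ν :* (δ :* κ) :+ ν :* κ)) refl

  numerator≡ε*denominator : ∀ p q .(c : Coprime.Coprime (suc p) (suc q)) →
    ℚ.mkℚ ℤ.+[1+ p ] q c ℚ.* ℕtoℚ (suc q) ≡ ℕtoℚ (suc p)
  numerator≡ε*denominator p q c = ℚ.toℚᵘ-injective
    (ℚᵘ.≃-trans (ℚ.toℚᵘ-homo-* (ℚ.mkℚ ℤ.+[1+ p ] q c) (ℕtoℚ (suc q))) unnormalised)
    where
    unnormalised :
      ℚ.toℚᵘ (ℚ.mkℚ ℤ.+[1+ p ] q c) ℚᵘ.* ℚ.toℚᵘ (ℕtoℚ (suc q)) ℚᵘ.≃ ℚ.toℚᵘ (ℕtoℚ (suc p))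
    unnormalised rewrite ℕtoℚ≡mkℚ (suc q) | ℕtoℚ≡mkℚ (suc p) = ℚᵘ.*≡* (cong (λ t → ℤ.+ suc t) (e p q))
      where
      e : ∀ p q → (q + p * suc q) * 1 ≡ q * 1 + p * suc (q * 1)
      e = solve-∀

  ≤-ε* : ∀ ε → ℚ.0ℚ ℚ.< ε → ∀ c N → c * ℚ.↧ₙ ε ≤ N → ℕtoℚ c ℚ.≤ ε ℚ.* ℕtoℚ N
  ≤-ε* ε@(ℚ.mkℚ ℤ.+[1+ p ] q cop) _ c N cq≤N = begin
    ℕtoℚ c                              ≡⟨ ℚ.*-identityʳ (ℕtoℚ c) ⟨
    ℕtoℚ c ℚ.* ℚ.1ℚ
      ≤⟨ ℚ.*-monoˡ-≤-nonNeg (ℕtoℚ c) ⦃ ℕtoℚ-nonNeg c ⦄ (ℕtoℚ-mono-≤ {1} {suc p} (s≤s z≤n)) ⟩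
    ℕtoℚ c ℚ.* ℕtoℚ (suc p)             ≡⟨ cong (ℕtoℚ c ℚ.*_) (numerator≡ε*denominator p q cop) ⟨
    ℕtoℚ c ℚ.* (ε ℚ.* ℕtoℚ (suc q))     ≡⟨ rearrange ⟩
    ε ℚ.* ℕtoℚ (c * suc q)              ≤⟨ ℚ.*-monoˡ-≤-nonNeg ε (ℕtoℚ-mono-≤ cq≤N) ⟩
    ε ℚ.* ℕtoℚ N                        ∎
    where
    open ℚ.≤-Reasoning
    rearrange : ℕtoℚ c ℚ.* (ε ℚ.* ℕtoℚ (suc q)) ≡ ε ℚ.* ℕtoℚ (c * suc q)
    rearrange = begin-equality
      ℕtoℚ c ℚ.* (ε ℚ.* ℕtoℚ (suc q))   ≡⟨ ℚ.*-assoc (ℕtoℚ c) ε (ℕtoℚ (suc q)) ⟨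
      ℕtoℚ c ℚ.* ε ℚ.* ℕtoℚ (suc q)     ≡⟨ cong (ℚ._* ℕtoℚ (suc q)) (ℚ.*-comm (ℕtoℚ c) ε) ⟩
      ε ℚ.* ℕtoℚ c ℚ.* ℕtoℚ (suc q)     ≡⟨ ℚ.*-assoc ε (ℕtoℚ c) (ℕtoℚ (suc q)) ⟩
      ε ℚ.* (ℕtoℚ c ℚ.* ℕtoℚ (suc q))   ≡⟨ cong (ε ℚ.*_) (ℕtoℚ-* c (suc q)) ⟨
      ε ℚ.* ℕtoℚ (c * suc q)            ∎
  ≤-ε* (ℚ.mkℚ (ℤ.+ zero) q cop) (ℚ.*<* (ℤ.+<+ ())) c N cq≤N
  ≤-ε* (ℚ.mkℚ ℤ.-[1+ p ] q cop) (ℚ.*<* ()) c N cq≤N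

  few-low-link-vertices : ∀ {n} K′ (H : ThreeGraph (suc n)) (x : Fin (suc n)) (x∉K4⁻ : NotInK4minus H x) →
    MinDegreeCond H n (1/suc K′) → 1 ≤ n → 120 ≤ suc K′ →
    let open K4⁻-free-vertex H x x∉K4⁻ in
    3 * sum (b2n ∘ low-link-degree n) * suc K′ ≤ 55 * (gap-scale * gap-scale) * suc K′ + 28 * (gap-scale * gap-scale) * n
  few-low-link-vertices {n} K′ H x x∉K4⁻ min-degree 1≤n 120≤K =
    low-count-bound (gap-scale * gap-scale) n (n * n) (suc K′) D (sum d) degree-square-sum (sum (b2n ∘ low-link-degree n))
                     1≤n (s≤s z≤n) n≤n² cstar degree-sum D≤∑d deviation D≤m²
    where
    open K4⁻-free-vertex H x x∉K4⁻
    v : Fin (suc n)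
    v = argmin (degree H) x (allFin (suc n))
    v-minimal : ∀ y → degree H v ≤ degree H y
    v-minimal y = All.lookup (f[argmin]≤f[xs] {f = degree H} x (allFin (suc n))) (∈-allFin y)
    D : ℕ
    D = 2 * degree H v
    n≤n² : n ≤ n * n
    n≤n² = m≤m*n n n ⦃ >-nonZero 1≤n ⦄
    cstar : 13 * ((n * n) * (n * n)) * (suc K′ * suc K′)
            ≤ (6 * D * suc K′ + 6 * (n * n) + (n * n) * suc K′) * (6 * D * suc K′ + 6 * (n * n) + (n * n) * suc K′)
    cstar = min-degree-cstar-bound K′ (n * n) D (min-degree v)
    degree-sum : suc n * D + 3 * degree-square-sum ≤ n * (n * n) + 3 * (n * n) + 3 * n + 1
    degree-sum = ≤-trans (+-monoˡ-≤ (3 * degree-square-sum)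
                            (≤-trans (≤-reflexive (sym (sum-const (suc n) D)))
                                     (sum-mono-≤ (λ y → *-monoʳ-≤ 2 (v-minimal y)))))
                   (≤-trans degree-sum-bound (≤-reflexive (cube n)))
      where
      cube : ∀ n → suc n * (suc n * suc n) ≡ n * (n * n) + 3 * (n * n) + 3 * n + 1
      cube = solve-∀
    D≤∑d : D ≤ sum d
    D≤∑d = subst (D ≤_) (sym ∑-link-degree) (*-monoʳ-≤ 2 (v-minimal x))
    17N≤40D : 17 * (n * n) ≤ 40 * D
    17N≤40D = cstar-bound⇒17N≤40D (n * n) (suc K′) D (≤-trans 1≤n n≤n²) 120≤K cstar
    deviation : sum (b2n ∘ low-link-degree n) * ((n * n) * (n * n)) + 2 * (gap-scale * gap-scale) * ((n * D) * sum d)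
                ≤ (gap-scale * gap-scale) * ((n * n) * degree-square-sum + suc n * (D * D))
    deviation = deviation-bound gap-scale n D (low-link-degree n) 1≤gap-scale
                  (λ y low-y → low-degree-gap n D (d y) 17N≤40D (<ᵇ-true⇒< low-y))
    D≤m² : D ≤ n * n + 2 * n + 1
    D≤m² = ≤-trans (m≤m+n D (neighbour-degree-sum v))
             (≤-trans (m≤m+n (D + neighbour-degree-sum v) (d v * d v + neighbour-degree-sum v))
             (≤-trans (vertex-bound v) (≤-reflexive (square n))))
      where
      square : ∀ n → suc n * suc n ≡ n * n + 2 * n + 1
      square = solve-∀

  -- With q the denominator of ε, so that ε ≥ 1/q, the choices δ = 1/(1 + 2000·gap-scale²·q) and
  -- n ≥ 5000·gap-scale²·q leave at most n/(100q) low link vertices.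
  link-nearly-bipartite : ∀ ε → ℚ.0ℚ ℚ.< ε → ∀ n → 5000 * (gap-scale * gap-scale) * ℚ.↧ₙ ε ≤ n →
    (H : ThreeGraph (suc n)) → MinDegreeCond H n (1/suc (2000 * (gap-scale * gap-scale) * ℚ.↧ₙ ε)) →
    (x : Fin (suc n)) → NotInK4minus H x → BipartiteAfterRemoving (link H x) (ε ℚ.* ℕtoℚ (n * n))
  link-nearly-bipartite ε 0<ε n n₀≤n H min-degree x x∉K4⁻ =
    at-low , at-low⊆G , ≤-ε* ε 0<ε (countPairs at-low) (n * n) removed ,
    bipartite dense (proj₁ high-vertex) (proj₂ high-vertex)
    where
    open K4⁻-free-vertex H x x∉K4⁻ using (G; G-sym; d; link-triangle-free; low-link-degree)
    open Bipartite-off-low G G-sym link-triangle-free (low-link-degree n)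
    q : ℕ
    q = ℚ.↧ₙ ε
    K′ : ℕ
    K′ = 2000 * (gap-scale * gap-scale) * q
    100≤n : 100 ≤ n
    100≤n = ≤-trans (m≤m+n 100 4900)
              (≤-trans (*-mono-≤ (*-monoʳ-≤ 5000 (*-mono-≤ 1≤gap-scale 1≤gap-scale)) (s≤s z≤n)) n₀≤n)
    120≤K : 120 ≤ suc K′
    120≤K = s≤s (≤-trans (m≤m+n 119 1881)
                  (*-mono-≤ (*-monoʳ-≤ 2000 (*-mono-≤ 1≤gap-scale 1≤gap-scale)) (s≤s z≤n)))
    100qk≤n : 100 * q * #low ≤ n
    100qk≤n = low-count-for-large-n gap-scale q n #low 1≤gap-scale 100≤n n₀≤n
                (few-low-link-vertices K′ H x x∉K4⁻ min-degree (≤-trans (s≤s z≤n) 100≤n) 120≤K)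
    100k≤n : 100 * #low ≤ n
    100k≤n = ≤-trans (*-monoˡ-≤ #low (*-monoʳ-≤ 100 {1} {q} (s≤s z≤n))) 100qk≤n
    dense : ∀ v → low-link-degree n v ≡ false → 2 * suc n < 5 * high-degree v
    dense v high = dense-if-few-low n (d v) (high-degree v) #low 100≤n 100k≤n
                     (degree≤high-degree+#low v) (<ᵇ-false⇒≥ high)
    high-vertex : ∃[ u ] low-link-degree n u ≡ false
    high-vertex = sum-b2n<⇒∃false (low-link-degree n) (s≤s (≤-trans (m≤n*m #low 100) 100k≤n))
    removed : countPairs at-low * q ≤ n * n
    removed = ≤-trans (*-monoˡ-≤ q countPairs-at-low)
                (removed-edges-bound n q #low (≤-trans (s≤s z≤n) 100≤n) 100qk≤n)

open import Data.Nat using (ℕ; suc; _≤_; _*_)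
open import Data.Fin using (Fin)
open import Data.Product using (_×_; ∃-syntax)
open import Data.Rational using (ℚ; 0ℚ; _<_)
open import Data.Rational using () renaming (_*_ to _*ℚ_)
open import Data.Product using (_,_)
open import Data.Rational using (↧ₙ_)

theorem1p2 : (ε : ℚ) → 0ℚ < ε →
    ∃[ δ ] (0ℚ < δ × ∃[ n₀ ] (∀ (n : ℕ) → n₀ ≤ n →
      (H : ThreeGraph (suc n)) → MinDegreeCond H n δ →
      (x : Fin (suc n)) → NotInK4minus H x →
      BipartiteAfterRemoving (link H x) (ε *ℚ ℕtoℚ (n * n))))
theorem1p2 ε 0<ε =
  1/suc K′ , 1/suc-positive K′ , 5000 * (gap-scale * gap-scale) * ↧ₙ ε , link-nearly-bipartite ε 0<ε
  where
  K′ : ℕ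
  K′ = 2000 * (gap-scale * gap-scale) * ↧ₙ ε
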